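{- Let $S\subset\mathbb{F}_2^n$ be nonempty and let $r=\dim\langle \mathbf{s}_0+S\rangle$ for some (equivalently, any) $\mathbf{s}_0\in S$. Then $S$ is fully balanced, i.e. $B(S)\cup C(S)=\mathbb{F}_2^n$, if and only if $b(S)=2^r-1$.
   Context: For $\mathbf{x},\mathbf{y}\in\mathbb{F}_2^n$ the pairing is $\mathbf{x}\cdot\mathbf{y}=\sum_{i=1}^n x_iy_i\in\mathbb{F}_2$, and $H_{\mathbf{y}}=\{\mathbf{x}\in\mathbb{F}_2^n\mid \mathbf{x}\cdot\mathbf{y}=0\}$. For a nonzero $\mathbf{y}$, a set $S$ is $\mathbf{y}$-balanced if $\#(S\cap H_{\mathbf{y}})=\#S/2$. $S$ is $\mathbf{y}$-constant if $S\subset H_{\mathbf{y}}$ or $S\cap H_{\mathbf{y}}=\emptyset$. The balancing set $B(S)$ is the set of nonzero $\mathbf{y}$ such that $S$ is $\mathbf{y}$-balanced; the constant set $C(S)$ is the set of $\mathbf{y}$ such that $S$ is $\mathbf{y}$-constant. The balancing number is $b(S)=\#B(S)/\#C(S)$. $\mathbf{s}_0+S=\{\mathbf{s}_0+\mathbf{x}\mid\mathbf{x}\in S\}$ and $\langle\cdot\rangle$ denotes linear span. -}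

module Defs where

open import Data.Bool using (Bool; true; false; _xor_; _∧_; if_then_else_; not)
open import Data.Nat using (ℕ; zero; suc; _*_; _∸_; _^_)
open import Data.Vec using (Vec; []; _∷_; zipWith; replicate; foldr)
open import Data.List using (List; []; _∷_; _++_; map; length; filter)
open import Data.List.Relation.Unary.All using (All)
open import Data.Product using (Σ; ∃; _×_; _,_)
open import Data.Sum using (_⊎_)
open import Data.Integer using (+_)
open import Data.Rational using (ℚ; _/_)
open import Relation.Binary.PropositionalEquality using (_≡_; _≢_)
open import Relation.Nullary using (¬_)
open import Relation.Nullary.Decidable using (Dec; yes; no)
open import Data.Nat using (_≟_)
open import Data.Bool using () renaming (_≟_ to _≟B_)
open import Function.Bundles using (_⇔_)

-- F_2 is Bool (false = 0, true = 1, _xor_ = +, _∧_ = ·); F_2^n is Vec Bool n.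
V : ℕ → Set
V n = Vec Bool n

0v : ∀ {n} → V n
0v = replicate _ false

_⊕_ : ∀ {n} → V n → V n → V n
_⊕_ = zipWith _xor_

dot : ∀ {n} → V n → V n → Bool
dot x y = foldr _ _xor_ false (zipWith _∧_ x y)

allV : (n : ℕ) → List (V n)
allV zero = [] ∷ []
allV (suc n) = map (false ∷_) (allV n) ++ map (true ∷_) (allV n)

Subset : ℕ → Set
Subset n = V n → Bool

card : ∀ {n} → Subset n → ℕ
card {n} T = length (filter (λ x → T x ≟B true) (allV n))

_∈_ : ∀ {n} → V n → Subset n → Set
x ∈ T = T x ≡ true

H : ∀ {n} → V n → Subset n
H y x = not (dot x y)

_∩_ : ∀ {n} → Subset n → Subset n → Subset n
(A ∩ B) x = A x ∧ B x

translate : ∀ {n} → V n → Subset n → Subset n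
translate s₀ S x = S (s₀ ⊕ x)

-- y-balanced: #(S ∩ H_y) = #S / 2  (stated without division: 2·#(S∩H_y) = #S)
Balanced : ∀ {n} → Subset n → V n → Set
Balanced S y = 2 * card (S ∩ H y) ≡ card S

Constant : ∀ {n} → Subset n → V n → Set
Constant S y = (∀ x → x ∈ S → x ∈ H y) ⊎ (∀ x → x ∈ S → ¬ (x ∈ H y))

InB : ∀ {n} → Subset n → V n → Set
InB S y = y ≢ 0v × Balanced S y

isBalanced : ∀ {n} → Subset n → V n → Bool
isBalanced S y with 2 * card (S ∩ H y) ≟ card S
... | yes _ = true
... | no _ = false

allInH : ∀ {n} → Subset n → V n → List (V n) → Bool
allInH S y [] = true
allInH S y (x ∷ xs) = (if S x then H y x else true) ∧ allInH S y xs

noneInH : ∀ {n} → Subset n → V n → List (V n) → Bool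
noneInH S y [] = true
noneInH S y (x ∷ xs) = (if S x then not (H y x) else true) ∧ noneInH S y xs

isZero : ∀ {n} → V n → Bool
isZero [] = true
isZero (b ∷ v) = not b ∧ isZero v

Bset : ∀ {n} → Subset n → Subset n
Bset S y = not (isZero y) ∧ isBalanced S y

Cset : ∀ {n} → Subset n → Subset n
Cset {n} S y with allInH S y (allV n)
... | true = true
... | false = noneInH S y (allV n)

-- ratio a / d in ℚ; the d = 0 branch is never used for b(S) since 0 ∈ C(S) always
ratio : ℕ → ℕ → ℚ
ratio a zero = + 0 / 1
ratio a (suc d) = + a / suc d

b : ∀ {n} → Subset n → ℚ
b S = ratio (card (Bset S)) (card (Cset S))

FullyBalanced : ∀ {n} → Subset n → Set
FullyBalanced S = ∀ y → InB S y ⊎ Constant S y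

sumL : ∀ {n} → List (V n) → V n
sumL [] = 0v
sumL (x ∷ xs) = x ⊕ sumL xs

_∈⟨_⟩ : ∀ {n} → V n → Subset n → Set
x ∈⟨ T ⟩ = Σ (List _) λ ts → All (λ t → t ∈ T) ts × sumL ts ≡ x

combo : ∀ {n k} → Vec (V n) k → Vec Bool k → V n
combo [] [] = 0v
combo (v ∷ bs) (c ∷ cs) = (if c then v else 0v) ⊕ combo bs cs

LinIndep : ∀ {n k} → Vec (V n) k → Set
LinIndep {k = k} bs = ∀ c → combo bs c ≡ 0v → c ≡ replicate k false

IsBasisOfSpan : ∀ {n k} → Subset n → Vec (V n) k → Set
IsBasisOfSpan T bs = LinIndep bs × (∀ x → (x ∈⟨ T ⟩) ⇔ (∃ λ c → combo bs c ≡ x))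

DimSpan : ∀ {n} → Subset n → ℕ → Set
DimSpan {n} T r = Σ (Vec (V n) r) λ bs → IsBasisOfSpan T bs

-- Since S ≠ ∅, no y makes S both y-balanced and y-constant, so B(S) and C(S) are
-- disjoint and S is fully balanced iff #B(S) + #C(S) = 2ⁿ.  S is y-constant iff y
-- annihilates s₀ + S, so C(S) = ⟨s₀ + S⟩^⊥ and 2ʳ · #C(S) = 2ⁿ; hence
-- #B(S) + #C(S) = 2ⁿ iff #B(S) = (2ʳ − 1) · #C(S).  The size of the annihilator of
-- a basis b₁ … b_r comes from double counting the pairs (y, c) ∈ F₂ⁿ × F₂ʳ with
-- (Σ cᵢ bᵢ) · y = 0, using that a nonzero linear form vanishes on exactly half the space.
module Submission where

open import Defs
open import Algebra using (CommutativeRing)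
open import Level using (0ℓ)
open import Data.Bool using (Bool; true; false; _xor_; _∧_; _∨_; if_then_else_; not)
open import Data.Bool using () renaming (_≟_ to _≟B_)
open import Data.Bool.Properties
  using ( xor-assoc; xor-same; xor-identityˡ; xor-identityʳ; ∧-distribʳ-xor; ∧-comm; ∧-zeroʳ
        ; xor-∧-commutativeRing; not-injective; not-¬; ¬-not; ⇔→≡; if-float)
open import Data.Empty using (⊥-elim)
open import Data.Integer using (+_)
import Data.Integer.Properties as ℤ
open import Data.List using (List; []; _∷_; _++_; map; length; filter)
open import Data.List.Properties using (length-++; length-map; length-filter)
open import Data.List.Membership.Propositional using () renaming (_∈_ to _∈ᴸ_)
open import Data.List.Membership.Propositional.Properties using (∈-++⁺ˡ; ∈-++⁺ʳ; ∈-map⁺)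
open import Data.List.Relation.Unary.All as All using (All; []; _∷_)
open import Data.List.Relation.Unary.Any using (here)
open import Data.Nat using (ℕ; zero; suc; _+_; _*_; _∸_; _^_; _≟_)
open import Data.Nat.Properties
open import Data.Nat.Tactic.RingSolver using (solve-∀)
open import Data.Product using (∃; _×_; _,_; proj₂)
open import Data.Rational using (_/_)
import Data.Rational.Properties as ℚ
open import Data.Rational.Unnormalised using (mkℚᵘ; *≡*)
open import Data.Sum using (_⊎_; inj₁; inj₂)
open import Data.Sum.Function.Propositional using (_⊎-⇔_)
open import Data.Vec using (Vec; []; _∷_)
import Data.Vec as Vec
open import Data.Vec.Properties using (zipWith-identityˡ; zipWith-identityʳ)
open import Function using (_∘_)
open import Function.Bundles using (_⇔_; mk⇔; Equivalence)
open import Function.Construct.Composition using (_⇔-∘_)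
open import Function.Properties.Equivalence using (⇔-setoid)
open import Relation.Binary.PropositionalEquality
open import Relation.Nullary using (¬_; yes; no)

open import Algebra.Properties.CommutativeSemigroup
  (CommutativeRing.+-commutativeSemigroup xor-∧-commutativeRing) using (interchange)

open Equivalence using (to; from)
open ≡-Reasoning
open import Relation.Binary.Reasoning.Setoid (⇔-setoid 0ℓ) using (step-≈-⟩; step-≈-⟨) renaming (begin_ to begin⇔_; _∎ to _∎⇔)

private variable
  A B : Set
  n k : ℕ

xor-cancelˡ : ∀ a b → a xor (a xor b) ≡ b
xor-cancelˡ a b = trans (sym (xor-assoc a a b)) (cong (_xor b) (xor-same a))

⊕-identityˡ : (x : V n) → 0v ⊕ x ≡ x
⊕-identityˡ = zipWith-identityˡ xor-identityˡ

⊕-identityʳ : (x : V n) → x ⊕ 0v ≡ x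
⊕-identityʳ = zipWith-identityʳ xor-identityʳ

⊕-cancelˡ : (s x : V n) → s ⊕ (s ⊕ x) ≡ x
⊕-cancelˡ [] [] = refl
⊕-cancelˡ (a ∷ s) (b ∷ x) = cong₂ _∷_ (xor-cancelˡ a b) (⊕-cancelˡ s x)

dot-⊕ˡ : (x z y : V n) → dot (x ⊕ z) y ≡ dot x y xor dot z y
dot-⊕ˡ [] [] [] = refl
dot-⊕ˡ (a ∷ x) (b ∷ z) (c ∷ y) = begin
  ((a xor b) ∧ c) xor dot (x ⊕ z) y
    ≡⟨ cong₂ _xor_ (∧-distribʳ-xor c a b) (dot-⊕ˡ x z y) ⟩
  ((a ∧ c) xor (b ∧ c)) xor (dot x y xor dot z y)
    ≡⟨ interchange (a ∧ c) (b ∧ c) (dot x y) (dot z y) ⟩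
  ((a ∧ c) xor dot x y) xor ((b ∧ c) xor dot z y)
    ∎

dot-0ˡ : (y : V n) → dot 0v y ≡ false
dot-0ˡ [] = refl
dot-0ˡ (c ∷ y) = dot-0ˡ y

dot-0ʳ : (x : V n) → dot x 0v ≡ false
dot-0ʳ [] = refl
dot-0ʳ (a ∷ x) = cong₂ _xor_ (∧-zeroʳ a) (dot-0ʳ x)

dot-comm : (x y : V n) → dot x y ≡ dot y x
dot-comm [] [] = refl
dot-comm (a ∷ x) (c ∷ y) = cong₂ _xor_ (∧-comm a c) (dot-comm x y)

dot-nondegenerate : (u : V n) → (∀ c → dot c u ≡ false) → u ≡ 0v
dot-nondegenerate [] _ = refl
dot-nondegenerate (h ∷ u) orth = cong₂ _∷_ h≡false (dot-nondegenerate u (λ c → orth (false ∷ c)))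
  where
  h≡false : h ≡ false
  h≡false = begin
    h                  ≡⟨ xor-identityʳ h ⟨
    h xor false        ≡⟨ cong (h xor_) (dot-0ˡ u) ⟨
    h xor dot 0v u     ≡⟨ orth (true ∷ 0v) ⟩
    false              ∎

dot-sumL : ∀ {T : Subset n} {y ts} → (∀ t → t ∈ T → dot t y ≡ false) →
           All (_∈ T) ts → dot (sumL ts) y ≡ false
dot-sumL {y = y} orth [] = dot-0ˡ y
dot-sumL {y = y} {t ∷ ts} orth (t∈T ∷ ts∈T) = begin
  dot (t ⊕ sumL ts) y          ≡⟨ dot-⊕ˡ t (sumL ts) y ⟩
  dot t y xor dot (sumL ts) y  ≡⟨ cong₂ _xor_ (orth t t∈T) (dot-sumL orth ts∈T) ⟩
  false                        ∎

pairings : Vec (V n) k → V n → V k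
pairings bs y = Vec.map (λ b → dot b y) bs

dot-combo : (bs : Vec (V n) k) (c : V k) (y : V n) → dot (combo bs c) y ≡ dot c (pairings bs y)
dot-combo [] [] y = dot-0ˡ y
dot-combo (v ∷ bs) (c ∷ cs) y = begin
  dot ((if c then v else 0v) ⊕ combo bs cs) y
    ≡⟨ dot-⊕ˡ (if c then v else 0v) (combo bs cs) y ⟩
  dot (if c then v else 0v) y xor dot (combo bs cs) y
    ≡⟨ cong₂ _xor_ (dot-if c) (dot-combo bs cs y) ⟩
  (c ∧ dot v y) xor dot cs (pairings bs y)
    ∎
  where
  dot-if : ∀ c → dot (if c then v else 0v) y ≡ c ∧ dot v y
  dot-if true = refl
  dot-if false = dot-0ˡ y

combo-0v : (bs : Vec (V n) k) → combo bs 0v ≡ 0v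
combo-0v [] = refl
combo-0v (v ∷ bs) = trans (⊕-identityˡ (combo bs 0v)) (combo-0v bs)

isZero-0v : isZero (0v {n}) ≡ true
isZero-0v {zero} = refl
isZero-0v {suc n} = isZero-0v {n}

isZero⇔≡0v : (v : V n) → isZero v ≡ true ⇔ v ≡ 0v
isZero⇔≡0v {n} v = mk⇔ (sound v) (λ { refl → isZero-0v {n} })
  where
  sound : ∀ {m} (v : V m) → isZero v ≡ true → v ≡ 0v
  sound [] _ = refl
  sound (false ∷ v) e = cong (false ∷_) (sound v e)
  sound (true ∷ v) ()

isZero-false⇒≢0v : ∀ {v : V n} → isZero v ≡ false → v ≢ 0v
isZero-false⇒≢0v {v = v} z v≡0v = not-¬ z (from (isZero⇔≡0v v) v≡0v)

isZero-combo : (bs : Vec (V n) k) → LinIndep bs → (c : V k) → isZero (combo bs c) ≡ isZero c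
isZero-combo bs indep c = ⇔→≡ (begin⇔
  isZero (combo bs c) ≡ true  ≈⟨ isZero⇔≡0v (combo bs c) ⟩
  combo bs c ≡ 0v             ≈⟨ mk⇔ (indep c) (λ { refl → combo-0v bs }) ⟩
  c ≡ 0v                      ≈⟨ isZero⇔≡0v c ⟨
  isZero c ≡ true             ∎⇔)

count : (A → Bool) → List A → ℕ
count p xs = length (filter (λ x → p x ≟B true) xs)

count-++ : (p : A → Bool) (xs ys : List A) → count p (xs ++ ys) ≡ count p xs + count p ys
count-++ p [] ys = refl
count-++ p (x ∷ xs) ys with p x
... | true = cong suc (count-++ p xs ys)
... | false = count-++ p xs ys

count-map : (p : B → Bool) (f : A → B) (xs : List A) → count p (map f xs) ≡ count (p ∘ f) xs
count-map p f [] = refl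
count-map p f (x ∷ xs) with p (f x)
... | true = cong suc (count-map p f xs)
... | false = count-map p f xs

count-cong : ∀ {p q : A → Bool} → (∀ x → p x ≡ q x) → (xs : List A) → count p xs ≡ count q xs
count-cong p≗q [] = refl
count-cong {p = p} {q} p≗q (x ∷ xs) with p x | q x | p≗q x
... | true | .true | refl = cong suc (count-cong p≗q xs)
... | false | .false | refl = count-cong p≗q xs

count-false : (xs : List A) → count (λ _ → false) xs ≡ 0
count-false [] = refl
count-false (x ∷ xs) = count-false xs

count-complement : (p : A → Bool) (xs : List A) → count p xs + count (not ∘ p) xs ≡ length xs
count-complement p [] = refl
count-complement p (x ∷ xs) with p x
... | true = cong suc (count-complement p xs)
... | false = trans (+-suc _ _) (cong suc (count-complement p xs))

count-∨ : ∀ {p q : A → Bool} → (∀ x → p x ≡ true → q x ≡ false) →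
          (xs : List A) → count (λ x → p x ∨ q x) xs ≡ count p xs + count q xs
count-∨ disjoint [] = refl
count-∨ {p = p} {q} disjoint (x ∷ xs) with p x in px | q x in qx
... | true | true = ⊥-elim (not-¬ (disjoint x px) qx)
... | true | false = cong suc (count-∨ disjoint xs)
... | false | true = trans (cong suc (count-∨ disjoint xs)) (sym (+-suc _ _))
... | false | false = count-∨ disjoint xs

count≡0⇒All : (p : A → Bool) (xs : List A) → count p xs ≡ 0 → All (λ x → p x ≡ false) xs
count≡0⇒All p [] _ = []
count≡0⇒All p (x ∷ xs) e with p x in px
count≡0⇒All p (x ∷ xs) () | true
... | false = px ∷ count≡0⇒All p xs e

count≡length⇔All : (p : A → Bool) (xs : List A) → count p xs ≡ length xs ⇔ All (λ x → p x ≡ true) xs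
count≡length⇔All {A} p xs = mk⇔ (sound xs) complete
  where
  sound : (xs : List A) → count p xs ≡ length xs → All (λ x → p x ≡ true) xs
  sound [] _ = []
  sound (x ∷ xs) e with p x in px
  ... | true = px ∷ sound xs (suc-injective e)
  ... | false = ⊥-elim (≤⇒≯ (length-filter (λ x → p x ≟B true) xs) (≤-reflexive (sym e)))
  complete : ∀ {xs} → All (λ x → p x ≡ true) xs → count p xs ≡ length xs
  complete [] = refl
  complete (px ∷ pxs) rewrite px = cong suc (complete pxs)

∈-allV : (x : V n) → x ∈ᴸ allV n
∈-allV [] = here refl
∈-allV {suc n} (false ∷ x) = ∈-++⁺ˡ (∈-map⁺ (false ∷_) (∈-allV x))
∈-allV {suc n} (true ∷ x) = ∈-++⁺ʳ (map (false ∷_) (allV n)) (∈-map⁺ (true ∷_) (∈-allV x))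

length-allV : ∀ n → length (allV n) ≡ 2 ^ n
length-allV zero = refl
length-allV (suc n) = begin
  length (map (false ∷_) (allV n) ++ map (true ∷_) (allV n))  ≡⟨ length-++ (map (false ∷_) (allV n)) ⟩
  length (map (false ∷_) (allV n)) + length (map (true ∷_) (allV n))
    ≡⟨ cong₂ _+_ (length-map (false ∷_) (allV n)) (length-map (true ∷_) (allV n)) ⟩
  length (allV n) + length (allV n)  ≡⟨ cong₂ _+_ (length-allV n) (trans (length-allV n) (sym (+-identityʳ _))) ⟩
  2 ^ n + (2 ^ n + 0)                 ∎

count-allV-suc : (p : V (suc n) → Bool) →
                 count p (allV (suc n)) ≡ count (p ∘ (false ∷_)) (allV n) + count (p ∘ (true ∷_)) (allV n)
count-allV-suc {n} p = begin
  count p (map (false ∷_) (allV n) ++ map (true ∷_) (allV n))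
    ≡⟨ count-++ p (map (false ∷_) (allV n)) _ ⟩
  count p (map (false ∷_) (allV n)) + count p (map (true ∷_) (allV n))
    ≡⟨ cong₂ _+_ (count-map p (false ∷_) (allV n)) (count-map p (true ∷_) (allV n)) ⟩
  count (p ∘ (false ∷_)) (allV n) + count (p ∘ (true ∷_)) (allV n)
    ∎

∀⇔count-allV≡2^ : (p : V n → Bool) → (∀ y → p y ≡ true) ⇔ count p (allV n) ≡ 2 ^ n
∀⇔count-allV≡2^ {n} p = mk⇔
  (λ all → trans (from (count≡length⇔All p (allV n)) (All.tabulate (λ {y} _ → all y))) (length-allV n))
  (λ e y → All.lookup (to (count≡length⇔All p (allV n)) (trans e (sym (length-allV n)))) (∈-allV y))

count-isZero : ∀ n → count isZero (allV n) ≡ 1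
count-isZero zero = refl
count-isZero (suc n) = begin
  count isZero (allV (suc n))                                  ≡⟨ count-allV-suc {n} isZero ⟩
  count isZero (allV n) + count (λ _ → false) (allV n)         ≡⟨ cong₂ _+_ (count-isZero n) (count-false (allV n)) ⟩
  1                                                            ∎

count-∷ : (p : A → Bool) (x : A) (xs : List A) → count p (x ∷ xs) ≡ (if p x then 1 else 0) + count p xs
count-∷ p x xs with p x
... | true = refl
... | false = refl

∑ : List A → (A → ℕ) → ℕ
∑ [] f = 0
∑ (x ∷ xs) f = f x + ∑ xs f

∑-cong : ∀ {f g : A → ℕ} → (∀ x → f x ≡ g x) → (xs : List A) → ∑ xs f ≡ ∑ xs g
∑-cong f≗g [] = refl
∑-cong f≗g (x ∷ xs) = cong₂ _+_ (f≗g x) (∑-cong f≗g xs)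

∑-+ : (xs : List A) (f g : A → ℕ) → ∑ xs (λ x → f x + g x) ≡ ∑ xs f + ∑ xs g
∑-+ [] f g = refl
∑-+ (x ∷ xs) f g = trans (cong (_+_ (f x + g x)) (∑-+ xs f g)) (interchange-+ (f x) (g x) (∑ xs f) (∑ xs g))
  where
  interchange-+ : ∀ a b c d → a + b + (c + d) ≡ a + c + (b + d)
  interchange-+ = solve-∀

∑-*ˡ : (k : ℕ) (xs : List A) (f : A → ℕ) → ∑ xs (λ x → k * f x) ≡ k * ∑ xs f
∑-*ˡ k [] f = sym (*-zeroʳ k)
∑-*ˡ k (x ∷ xs) f = trans (cong (_+_ (k * f x)) (∑-*ˡ k xs f)) (sym (*-distribˡ-+ k (f x) (∑ xs f)))

∑-const : (xs : List A) (a : ℕ) → ∑ xs (λ _ → a) ≡ length xs * a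
∑-const [] a = refl
∑-const (x ∷ xs) a = cong (_+_ a) (∑-const xs a)

∑-indicator : (xs : List A) (p : A → Bool) (a : ℕ) → ∑ xs (λ x → if p x then a else 0) ≡ count p xs * a
∑-indicator [] p a = refl
∑-indicator (x ∷ xs) p a with p x
... | true = cong (_+_ a) (∑-indicator xs p a)
... | false = ∑-indicator xs p a

∑-affine : (xs : List A) (p : A → Bool) (a b : ℕ) →
           ∑ xs (λ x → a + (if p x then b else 0)) ≡ length xs * a + count p xs * b
∑-affine xs p a b = trans (∑-+ xs (λ _ → a) _) (cong₂ _+_ (∑-const xs a) (∑-indicator xs p b))

∑-count-comm : (p : A → B → Bool) (xs : List A) (ys : List B) →
               ∑ xs (λ x → count (p x) ys) ≡ ∑ ys (λ y → count (λ x → p x y) xs)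
∑-count-comm p [] ys = sym (trans (∑-const ys 0) (*-zeroʳ (length ys)))
∑-count-comm p (x ∷ xs) ys = begin
  count (p x) ys + ∑ xs (λ x → count (p x) ys)
    ≡⟨ cong (_+_ (count (p x) ys)) (∑-count-comm p xs ys) ⟩
  count (p x) ys + ∑ ys (λ y → count (λ x → p x y) xs)
    ≡⟨ cong (_+ ∑ ys (λ y → count (λ x → p x y) xs)) (trans (∑-indicator ys (p x) 1) (*-identityʳ _)) ⟨
  ∑ ys (λ y → if p x y then 1 else 0) + ∑ ys (λ y → count (λ x → p x y) xs)
    ≡⟨ ∑-+ ys _ _ ⟨
  ∑ ys (λ y → (if p x y then 1 else 0) + count (λ x → p x y) xs)
    ≡⟨ ∑-cong (λ y → count-∷ (λ x → p x y) x xs) ys ⟨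
  ∑ ys (λ y → count (λ x → p x y) (x ∷ xs))
    ∎

-- #H_w is 2ⁿ⁻¹ for w ≠ 0 and 2ⁿ for w = 0; doubling avoids the predecessor.
2*card-H : (w : V n) → 2 * card (H w) ≡ 2 ^ n + (if isZero w then 2 ^ n else 0)
2*card-H [] = refl
2*card-H {suc n} (false ∷ w) = begin
  2 * card (H (false ∷ w))           ≡⟨ cong (2 *_) (count-allV-suc (H (false ∷ w))) ⟩
  2 * (card (H w) + card (H w))      ≡⟨ *-distribˡ-+ 2 (card (H w)) (card (H w)) ⟩
  2 * card (H w) + 2 * card (H w)    ≡⟨ cong₂ _+_ (2*card-H w) (2*card-H w) ⟩
  (P + Q) + (P + Q)                  ≡⟨ double-sum P Q ⟩
  2 * P + 2 * Q                      ≡⟨ cong (_+_ (2 * P)) (if-float (2 *_) (isZero w)) ⟩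
  2 * P + (if isZero w then 2 * P else 0)  ∎
  where
  P = 2 ^ n
  Q = if isZero w then 2 ^ n else 0
  double-sum : ∀ p q → (p + q) + (p + q) ≡ 2 * p + 2 * q
  double-sum = solve-∀
2*card-H {suc n} (true ∷ w) = begin
  2 * card (H (true ∷ w))                        ≡⟨ cong (2 *_) (count-allV-suc (H (true ∷ w))) ⟩
  2 * (card (H w) + count (not ∘ H w) (allV n))  ≡⟨ cong (2 *_) (count-complement (H w) (allV n)) ⟩
  2 * length (allV n)                            ≡⟨ cong (2 *_) (length-allV n) ⟩
  2 * 2 ^ n                                      ≡⟨ +-identityʳ _ ⟨
  2 * 2 ^ n + 0                                  ∎

orthogonal : Vec (V n) k → V n → Bool
orthogonal bs y = isZero (pairings bs y)

count-orthogonal : (bs : Vec (V n) k) → LinIndep bs → count (orthogonal bs) (allV n) * 2 ^ k ≡ 2 ^ n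
count-orthogonal {n} {k} bs indep = +-cancelˡ-≡ (2 ^ n * 2 ^ k) _ _ (begin
  2 ^ n * 2 ^ k + N * 2 ^ k                                    ≡⟨ by-y ⟨
  2 * ∑ (allV n) (λ y → count (incident y) (allV k))           ≡⟨ cong (2 *_) (∑-count-comm incident (allV n) (allV k)) ⟩
  2 * ∑ (allV k) (λ c → count (λ y → incident y c) (allV n))   ≡⟨ by-c ⟩
  2 ^ n * 2 ^ k + 2 ^ n                                        ∎)
  where
  N = count (orthogonal bs) (allV n)
  incident : V n → V k → Bool
  incident y c = H y (combo bs c)
  by-y : 2 * ∑ (allV n) (λ y → count (incident y) (allV k)) ≡ 2 ^ n * 2 ^ k + N * 2 ^ k
  by-y = begin
    2 * ∑ (allV n) (λ y → count (incident y) (allV k))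
      ≡⟨ ∑-*ˡ 2 (allV n) _ ⟨
    ∑ (allV n) (λ y → 2 * count (incident y) (allV k))
      ≡⟨ ∑-cong (λ y → cong (2 *_) (count-cong (λ c → cong not (dot-combo bs c y)) (allV k))) (allV n) ⟩
    ∑ (allV n) (λ y → 2 * card (H (pairings bs y)))
      ≡⟨ ∑-cong (λ y → 2*card-H (pairings bs y)) (allV n) ⟩
    ∑ (allV n) (λ y → 2 ^ k + (if orthogonal bs y then 2 ^ k else 0))
      ≡⟨ ∑-affine (allV n) (orthogonal bs) (2 ^ k) (2 ^ k) ⟩
    length (allV n) * 2 ^ k + N * 2 ^ k
      ≡⟨ cong (λ m → m * 2 ^ k + N * 2 ^ k) (length-allV n) ⟩
    2 ^ n * 2 ^ k + N * 2 ^ k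
      ∎
  by-c : 2 * ∑ (allV k) (λ c → count (λ y → incident y c) (allV n)) ≡ 2 ^ n * 2 ^ k + 2 ^ n
  by-c = begin
    2 * ∑ (allV k) (λ c → count (λ y → incident y c) (allV n))
      ≡⟨ ∑-*ˡ 2 (allV k) _ ⟨
    ∑ (allV k) (λ c → 2 * count (λ y → incident y c) (allV n))
      ≡⟨ ∑-cong (λ c → cong (2 *_) (count-cong (λ y → cong not (dot-comm (combo bs c) y)) (allV n))) (allV k) ⟩
    ∑ (allV k) (λ c → 2 * card (H (combo bs c)))
      ≡⟨ ∑-cong (λ c → trans (2*card-H (combo bs c))
                             (cong (λ z → 2 ^ n + (if z then 2 ^ n else 0)) (isZero-combo bs indep c))) (allV k) ⟩
    ∑ (allV k) (λ c → 2 ^ n + (if isZero c then 2 ^ n else 0))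
      ≡⟨ ∑-affine (allV k) isZero (2 ^ n) (2 ^ n) ⟩
    length (allV k) * 2 ^ n + count isZero (allV k) * 2 ^ n
      ≡⟨ cong₂ (λ a b → a * 2 ^ n + b * 2 ^ n) (length-allV k) (count-isZero k) ⟩
    2 ^ k * 2 ^ n + 1 * 2 ^ n
      ≡⟨ cong₂ _+_ (*-comm (2 ^ k) (2 ^ n)) (*-identityˡ (2 ^ n)) ⟩
    2 ^ n * 2 ^ k + 2 ^ n
      ∎

∧≡true⇔ : ∀ {a b} → a ∧ b ≡ true ⇔ (a ≡ true × b ≡ true)
∧≡true⇔ {true} = mk⇔ (refl ,_) proj₂
∧≡true⇔ {false} = mk⇔ (λ ()) (λ { (() , _) })

∨≡true⇔ : ∀ {a b} → a ∨ b ≡ true ⇔ (a ≡ true ⊎ b ≡ true)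
∨≡true⇔ {true} = mk⇔ inj₁ (λ _ → refl)
∨≡true⇔ {false} = mk⇔ inj₂ (λ { (inj₁ ()) ; (inj₂ b) → b })

if-then-true⇔ : ∀ {a b} → (if a then b else true) ≡ true ⇔ (a ≡ true → b ≡ true)
if-then-true⇔ {true} = mk⇔ (λ b _ → b) (λ f → f refl)
if-then-true⇔ {false} = mk⇔ (λ _ ()) (λ _ → refl)

not≡true⇔ : ∀ {b} → not b ≡ true ⇔ (¬ b ≡ true)
not≡true⇔ {true} = mk⇔ (λ ()) (λ b≢true → ⊥-elim (b≢true refl))
not≡true⇔ {false} = mk⇔ (λ _ ()) (λ _ → refl)

module _ (S : Subset n) (y : V n) where

  allInH⇔All : (xs : List (V n)) → allInH S y xs ≡ true ⇔ All (λ x → x ∈ S → x ∈ H y) xs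
  allInH⇔All [] = mk⇔ (λ _ → []) (λ _ → refl)
  allInH⇔All (x ∷ xs) = mk⇔
    (λ e → let (hd , tl) = to ∧≡true⇔ e in to if-then-true⇔ hd ∷ to (allInH⇔All xs) tl)
    (λ { (hd ∷ tl) → from ∧≡true⇔ (from if-then-true⇔ hd , from (allInH⇔All xs) tl) })

  noneInH⇔All : (xs : List (V n)) → noneInH S y xs ≡ true ⇔ All (λ x → x ∈ S → ¬ x ∈ H y) xs
  noneInH⇔All [] = mk⇔ (λ _ → []) (λ _ → refl)
  noneInH⇔All (x ∷ xs) = mk⇔
    (λ e → let (hd , tl) = to ∧≡true⇔ e in to not≡true⇔ ∘ to if-then-true⇔ hd ∷ to (noneInH⇔All xs) tl)
    (λ { (hd ∷ tl) → from ∧≡true⇔ (from if-then-true⇔ (from not≡true⇔ ∘ hd) , from (noneInH⇔All xs) tl) })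

  Cset-reflects : Cset S y ≡ true ⇔ Constant S y
  Cset-reflects with allInH S y (allV n) in allIn
  ... | true = mk⇔ (λ _ → inj₁ (λ x → All.lookup (to (allInH⇔All (allV n)) allIn) (∈-allV x))) (λ _ → refl)
  ... | false = mk⇔
    (λ noneIn → inj₂ (λ x → All.lookup (to (noneInH⇔All (allV n)) noneIn) (∈-allV x)))
    (λ { (inj₁ inH) → ⊥-elim (not-¬ allIn (from (allInH⇔All (allV n)) (All.tabulate (λ {x} _ → inH x))))
       ; (inj₂ outH) → from (noneInH⇔All (allV n)) (All.tabulate (λ {x} _ → outH x)) })

  isBalanced-reflects : isBalanced S y ≡ true ⇔ Balanced S y
  isBalanced-reflects with 2 * card (S ∩ H y) ≟ card S
  ... | yes bal = mk⇔ (λ _ → bal) (λ _ → refl)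
  ... | no ¬bal = mk⇔ (λ ()) (⊥-elim ∘ ¬bal)

  Bset-reflects : Bset S y ≡ true ⇔ InB S y
  Bset-reflects with isZero y in isZero-y
  ... | true = mk⇔ (λ ()) (λ (y≢0v , _) → ⊥-elim (y≢0v (to (isZero⇔≡0v y) isZero-y)))
  ... | false = mk⇔ (λ bal → isZero-false⇒≢0v isZero-y , to isBalanced-reflects bal) (from isBalanced-reflects ∘ proj₂)

_⟂_ : V n → Subset n → Set
y ⟂ T = ∀ t → t ∈ T → dot t y ≡ false

constant⇔H-constant : ∀ {S : Subset n} {s₀ y} → s₀ ∈ S → Constant S y ⇔ (∀ x → x ∈ S → H y x ≡ H y s₀)
constant⇔H-constant {S = S} {s₀} {y} s₀∈S = mk⇔ same-side (split (H y s₀) refl)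
  where
  same-side : Constant S y → ∀ x → x ∈ S → H y x ≡ H y s₀
  same-side (inj₁ inH) x x∈S = trans (inH x x∈S) (sym (inH s₀ s₀∈S))
  same-side (inj₂ outH) x x∈S = trans (¬-not (outH x x∈S)) (sym (¬-not (outH s₀ s₀∈S)))
  split : ∀ b → H y s₀ ≡ b → (∀ x → x ∈ S → H y x ≡ H y s₀) → Constant S y
  split true h same = inj₁ (λ x x∈S → trans (same x x∈S) h)
  split false h same = inj₂ (λ x x∈S → not-¬ (trans (same x x∈S) h))

H-constant⇔⟂translate : ∀ {S : Subset n} {s₀ y} → (∀ x → x ∈ S → H y x ≡ H y s₀) ⇔ y ⟂ translate s₀ S
H-constant⇔⟂translate {S = S} {s₀} {y} = mk⇔ to⟂ from⟂
  where
  a = dot s₀ y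
  to⟂ : (∀ x → x ∈ S → H y x ≡ H y s₀) → y ⟂ translate s₀ S
  to⟂ same t t∈s₀+S = begin
    dot t y                ≡⟨ xor-cancelˡ a (dot t y) ⟨
    a xor (a xor dot t y)  ≡⟨ cong (a xor_) (trans (sym (dot-⊕ˡ s₀ t y)) (not-injective (same (s₀ ⊕ t) t∈s₀+S))) ⟩
    a xor a                ≡⟨ xor-same a ⟩
    false                  ∎
  from⟂ : y ⟂ translate s₀ S → ∀ x → x ∈ S → H y x ≡ H y s₀
  from⟂ y⟂ x x∈S = cong not (begin
    dot x y                ≡⟨ xor-cancelˡ a (dot x y) ⟨
    a xor (a xor dot x y)  ≡⟨ cong (a xor_) (trans (sym (dot-⊕ˡ s₀ x y)) (y⟂ (s₀ ⊕ x) s₀⊕x∈s₀+S)) ⟩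
    a xor false            ≡⟨ xor-identityʳ a ⟩
    a                      ∎)
    where
    s₀⊕x∈s₀+S : (s₀ ⊕ x) ∈ translate s₀ S
    s₀⊕x∈s₀+S = trans (cong S (⊕-cancelˡ s₀ x)) x∈S

⟂⇔pairings≡0v : ∀ {T : Subset n} {bs : Vec (V n) k} {y} →
                (∀ x → (x ∈⟨ T ⟩) ⇔ (∃ λ c → combo bs c ≡ x)) → y ⟂ T ⇔ pairings bs y ≡ 0v
⟂⇔pairings≡0v {T = T} {bs} {y} span = mk⇔
  (λ y⟂T → dot-nondegenerate (pairings bs y) (λ c → trans (sym (dot-combo bs c y)) (vanishes-on-combo y⟂T c)))
  (λ pairings≡0v t t∈T → let (c , combo≡t) = to (span t) (t ∷ [] , t∈T ∷ [] , ⊕-identityʳ t) in begin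
    dot t y                   ≡⟨ cong (λ z → dot z y) combo≡t ⟨
    dot (combo bs c) y        ≡⟨ dot-combo bs c y ⟩
    dot c (pairings bs y)     ≡⟨ cong (dot c) pairings≡0v ⟩
    dot c 0v                  ≡⟨ dot-0ʳ c ⟩
    false                     ∎)
  where
  vanishes-on-combo : y ⟂ T → ∀ c → dot (combo bs c) y ≡ false
  vanishes-on-combo y⟂T c = let (ts , ts∈T , sum≡combo) = from (span (combo bs c)) (c , refl) in
    trans (cong (λ z → dot z y) (sym sum≡combo)) (dot-sumL y⟂T ts∈T)

card-Cset : ∀ {S : Subset n} {s₀ r} → s₀ ∈ S → DimSpan (translate s₀ S) r → card (Cset S) * 2 ^ r ≡ 2 ^ n
card-Cset {n} {S} {s₀} {r} s₀∈S (bs , indep , span) =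
  trans (cong (_* 2 ^ r) (count-cong Cset≗orthogonal (allV n))) (count-orthogonal bs indep)
  where
  Cset≗orthogonal : ∀ y → Cset S y ≡ orthogonal bs y
  Cset≗orthogonal y = ⇔→≡ (begin⇔
    Cset S y ≡ true                  ≈⟨ Cset-reflects S y ⟩
    Constant S y                     ≈⟨ constant⇔H-constant s₀∈S ⟩
    (∀ x → x ∈ S → H y x ≡ H y s₀)   ≈⟨ H-constant⇔⟂translate ⟩
    y ⟂ translate s₀ S               ≈⟨ ⟂⇔pairings≡0v span ⟩
    pairings bs y ≡ 0v               ≈⟨ isZero⇔≡0v (pairings bs y) ⟨
    orthogonal bs y ≡ true           ∎⇔)

card-nonempty : ∀ {T : Subset n} {x} → x ∈ T → card T ≢ 0
card-nonempty {n} {T} {x} x∈T #T≡0 = not-¬ (All.lookup (count≡0⇒All T (allV n) #T≡0) (∈-allV x)) x∈T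

balanced⇒¬constant : ∀ {S : Subset n} {s₀ y} → s₀ ∈ S → Balanced S y → ¬ Constant S y
balanced⇒¬constant {n} {S} {s₀} {y} s₀∈S bal = card-nonempty {T = S} s₀∈S ∘ card≡0
  where
  card≡0 : Constant S y → card S ≡ 0
  card≡0 (inj₁ inH) = double≡self⇒0 (trans (cong (2 *_) (sym (count-cong ∩H≗S (allV n)))) bal)
    where
    ∩H≗S : ∀ x → (S ∩ H y) x ≡ S x
    ∩H≗S x with S x in x∈S
    ... | true = inH x x∈S
    ... | false = refl
    double≡self⇒0 : ∀ {c} → 2 * c ≡ c → c ≡ 0
    double≡self⇒0 {c} e = trans (sym (+-identityʳ c)) (+-cancelˡ-≡ c (c + 0) 0 (trans e (sym (+-identityʳ c))))
  card≡0 (inj₂ outH) = trans (sym bal) (cong (2 *_) (trans (count-cong ∩H≗∅ (allV n)) (count-false (allV n))))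
    where
    ∩H≗∅ : ∀ x → (S ∩ H y) x ≡ false
    ∩H≗∅ x with S x in x∈S
    ... | true = ¬-not (outH x x∈S)
    ... | false = refl

fullyBalanced⇔card : ∀ {S : Subset n} {s₀} → s₀ ∈ S → FullyBalanced S ⇔ (card (Bset S) + card (Cset S) ≡ 2 ^ n)
fullyBalanced⇔card {n} {S} s₀∈S = begin⇔
  FullyBalanced S                                     ≈⟨ mk⇔ (λ fb y → from (covered y) (fb y)) (λ c y → to (covered y) (c y)) ⟩
  (∀ y → Bset S y ∨ Cset S y ≡ true)                  ≈⟨ ∀⇔count-allV≡2^ (λ y → Bset S y ∨ Cset S y) ⟩
  count (λ y → Bset S y ∨ Cset S y) (allV n) ≡ 2 ^ n  ≈⟨ mk⇔ (trans (sym B∨C≡B+C)) (trans B∨C≡B+C) ⟩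
  card (Bset S) + card (Cset S) ≡ 2 ^ n               ∎⇔
  where
  covered : ∀ y → Bset S y ∨ Cset S y ≡ true ⇔ (InB S y ⊎ Constant S y)
  covered y = (Bset-reflects S y ⊎-⇔ Cset-reflects S y) ⇔-∘ ∨≡true⇔
  disjoint : ∀ y → Bset S y ≡ true → Cset S y ≡ false
  disjoint y inB = ¬-not (balanced⇒¬constant s₀∈S (proj₂ (to (Bset-reflects S y) inB)) ∘ to (Cset-reflects S y))
  B∨C≡B+C : count (λ y → Bset S y ∨ Cset S y) (allV n) ≡ card (Bset S) + card (Cset S)
  B∨C≡B+C = count-∨ disjoint (allV n)

ratio≡⇔ : ∀ a d m → ratio a (suc d) ≡ + m / 1 ⇔ a ≡ m * suc d
ratio≡⇔ a d m = mk⇔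
  (λ eq → trans (sym (*-identityʳ a)) (ℚ.normalize-injective-≃ a m (suc d) 1 eq))
  (λ eq → ℚ.fromℚᵘ-cong {mkℚᵘ (+ a) d} {mkℚᵘ (+ m) 0}
            (*≡* (trans (ℤ.*-identityʳ (+ a)) (trans (cong +_ eq) (ℤ.pos-* m (suc d))))))

ratio-criterion : ∀ B C r n → C * 2 ^ r ≡ 2 ^ n → (B + C ≡ 2 ^ n) ⇔ (ratio B C ≡ + (2 ^ r ∸ 1) / 1)
ratio-criterion B zero r n e = ⊥-elim (<⇒≢ (m^n>0 2 n) e)
ratio-criterion B (suc d) r n e = subst (λ N → (B + C ≡ N) ⇔ _) e
  (mk⇔ (λ B+C≡ → from (ratio≡⇔ B d m) (+-cancelʳ-≡ C B (m * C) (trans B+C≡ C*2^r≡m*C+C)))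
       (λ ratio≡ → trans (cong (_+ C) (to (ratio≡⇔ B d m) ratio≡)) (sym C*2^r≡m*C+C)))
  where
  C = suc d
  m = 2 ^ r ∸ 1
  C*2^r≡m*C+C : C * 2 ^ r ≡ m * C + C
  C*2^r≡m*C+C = begin
    C * 2 ^ r            ≡⟨ *-comm C (2 ^ r) ⟩
    2 ^ r * C            ≡⟨ cong (_* C) (m∸n+n≡m (m^n>0 2 r)) ⟨
    (m + 1) * C          ≡⟨ *-distribʳ-+ C m 1 ⟩
    m * C + 1 * C        ≡⟨ cong (_+_ (m * C)) (*-identityˡ C) ⟩
    m * C + C            ∎

proposition4 : (n : ℕ) (S : Subset n) (s₀ : V n) → s₀ ∈ S → (r : ℕ) →
    DimSpan (translate s₀ S) r →
    FullyBalanced S ⇔ (b S ≡ (+ (2 ^ r ∸ 1)) / 1)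
proposition4 n S s₀ s₀∈S r dim =
  ratio-criterion (card (Bset S)) (card (Cset S)) r n (card-Cset s₀∈S dim) ⇔-∘ fullyBalanced⇔card s₀∈S
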